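{- Let $n$ be a positive integer and $\lambda$ a partition of $n$. Then $g(\lambda)=e_2(\widetilde{\lambda})$, where $\widetilde{\lambda}$ is the conjugate partition of $\lambda$.
   Context: A partition $\lambda$ of $n$ is a non-increasing sequence of positive integers $(\lambda_1,\ldots,\lambda_\ell)$ summing to $n$; it is padded with zeros to $(\lambda_1,\ldots,\lambda_n)$ (i.e. $\lambda_i=0$ for $\ell<i\le n$). The Gini index of $\lambda$ is defined by \[g(\lambda)=\binom{n+1}{2}-\sum_{i=1}^{n} i\,\lambda_i\] (equivalently, $g(\lambda)=\int_0^n(\lceil x\rceil-L_\lambda(x))\,dx$, where $L_\lambda(0)=0$ and $L_\lambda(x)=\sum_{i=n-k+1}^{n}\lambda_i$ for $x\in(k-1,k]$, $1\le k\le n$). The conjugate partition $\widetilde{\lambda}$ is obtained by reflecting the Young diagram of $\lambda$ across its main diagonal, i.e. $\widetilde{\lambda}_j=\#\{i:\lambda_i\ge j\}$. For a partition $\mu=(\mu_1,\ldots,\mu_m)$, $e_2(\mu)=\sum_{1\le i<j\le m}\mu_i\mu_j$ is the second elementary symmetric polynomial evaluated at its parts. -}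

module Defs where

open import Data.Nat using (ℕ; zero; suc; _+_; _*_; _≤_; _≥_; _<_)
open import Data.Nat.Combinatorics using (_C_)
open import Data.Nat.ListAction using (sum)
open import Data.List using (List; []; _∷_; length; filter; map; upTo; head)
open import Data.List.Relation.Unary.All using (All)
open import Data.List.Relation.Unary.Linked using (Linked)
open import Data.Nat.Properties using (_≤?_)
open import Data.Integer using (ℤ; +_; _-_)
open import Data.Product using (_×_)
open import Relation.Binary.PropositionalEquality using (_≡_)

IsPartition : ℕ → List ℕ → Set
IsPartition n λs = All (λ p → 1 ≤ p) λs × Linked _≥_ λs × sum λs ≡ n

weightedSumFrom : ℕ → List ℕ → ℕ
weightedSumFrom k [] = 0
weightedSumFrom k (x ∷ xs) = k * x + weightedSumFrom (suc k) xs

weightedSum : List ℕ → ℕ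
weightedSum = weightedSumFrom 1

gini : ℕ → List ℕ → ℤ
gini n λs = + ((suc n) C 2) - + (weightedSum λs)

largestPart : List ℕ → ℕ
largestPart [] = 0
largestPart (x ∷ _) = x

-- conjugate: λ̃_j = #{i : λ_i ≥ j} for j = 1 .. λ_1
conjugate : List ℕ → List ℕ
conjugate λs = map (λ j → length (filter (λ p → suc j ≤? p) λs)) (upTo (largestPart λs))

e₂ : List ℕ → ℕ
e₂ [] = 0
e₂ (x ∷ xs) = x * sum xs + e₂ xs

-- Let T(a) = 1 + 2 + ⋯ + a = C(a+1, 2). Since T(a + b) = T(a) + T(b) + ab, for
-- any list μ we get T(Σ μ) = Σ T(μ_j) + e₂(μ). Apply this to μ = λ̃: its parts
-- sum to n, and Σ_j T(λ̃_j) = Σ_i i λ_i, because the cell in row i of column j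
-- is the i-th cell of that column. Hence C(n+1, 2) = Σ_i i λ_i + e₂(λ̃).
module Submission where

open import Defs
open import Data.Nat using (ℕ; zero; suc; _+_; _*_; _≤_; _≥_; z≤n; s≤s)
open import Data.Nat.Properties
open import Data.Nat.Combinatorics using (_C_; nCk+nC[k+1]≡[n+1]C[k+1]; nC1≡n)
open import Data.Nat.ListAction using (sum)
open import Data.Nat.Solver using (module +-*-Solver)
open import Data.Integer using (+_; _-_; _⊖_)
open import Data.Integer.Properties using (m-n≡m⊖n; +-cancelˡ-⊖)
open import Data.List using (List; []; _∷_; length; filter; map; applyUpTo)
open import Data.List.Properties using (filter-accept; filter-reject; map-applyUpTo)
open import Data.List.Relation.Unary.All as All using (All; []; _∷_)
open import Data.List.Relation.Unary.Linked as Linked using (Linked; [])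
open import Data.List.Relation.Unary.Linked.Properties using (Linked⇒All)
open import Data.Product using (_,_)
open import Relation.Nullary using (yes; no; ¬_; contradiction)
open import Relation.Binary.PropositionalEquality
open ≡-Reasoning
open +-*-Solver

triangle : ℕ → ℕ
triangle zero    = 0
triangle (suc n) = suc n + triangle n

[1+n]C2≡triangle : ∀ n → suc n C 2 ≡ triangle n
[1+n]C2≡triangle zero    = refl
[1+n]C2≡triangle (suc n) = begin
  suc (suc n) C 2        ≡⟨ nCk+nC[k+1]≡[n+1]C[k+1] (suc n) 1 ⟨
  suc n C 1 + suc n C 2  ≡⟨ cong₂ _+_ (nC1≡n (suc n)) ([1+n]C2≡triangle n) ⟩
  suc n + triangle n     ∎

triangle-+ : ∀ m n → triangle (m + n) ≡ triangle m + triangle n + m * n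
triangle-+ zero    n = sym (+-identityʳ (triangle n))
triangle-+ (suc m) n rewrite triangle-+ m n =
  solve 4 (λ m n t u → (con 1 :+ m :+ n) :+ (t :+ u :+ m :* n)
                     := (con 1 :+ m :+ t) :+ u :+ (con 1 :+ m) :* n)
          refl m n (triangle m) (triangle n)

triangle-sum : ∀ μ → triangle (sum μ) ≡ sum (map triangle μ) + e₂ μ
triangle-sum []       = refl
triangle-sum (x ∷ xs) rewrite triangle-+ x (sum xs) | triangle-sum xs =
  solve 4 (λ t s e p → t :+ (s :+ e) :+ p := t :+ s :+ (p :+ e))
          refl (triangle x) (sum (map triangle xs)) (e₂ xs) (x * sum xs)

sumBelow : ℕ → (ℕ → ℕ) → ℕ
sumBelow m f = sum (applyUpTo f m)

syntax sumBelow m (λ j → e) = ∑[ j < m ] e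

sumBelow-cong : ∀ m {f g : ℕ → ℕ} → (∀ j → f j ≡ g j) → ∑[ j < m ] f j ≡ ∑[ j < m ] g j
sumBelow-cong zero    f≗g = refl
sumBelow-cong (suc m) f≗g = cong₂ _+_ (f≗g 0) (sumBelow-cong m (λ j → f≗g (suc j)))

sumBelow-+ : ∀ m (f g : ℕ → ℕ) → ∑[ j < m ] (f j + g j) ≡ ∑[ j < m ] f j + ∑[ j < m ] g j
sumBelow-+ zero    f g = refl
sumBelow-+ (suc m) f g rewrite sumBelow-+ m (λ j → f (suc j)) (λ j → g (suc j)) =
  solve 4 (λ a b c d → a :+ b :+ (c :+ d) := a :+ c :+ (b :+ d))
          refl (f 0) (g 0) (∑[ j < m ] f (suc j)) (∑[ j < m ] g (suc j))

sumBelow-const : ∀ m c → ∑[ j < m ] c ≡ m * c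
sumBelow-const zero    c = refl
sumBelow-const (suc m) c = cong (_+_ c) (sumBelow-const m c)

𝟙[_<_] : ℕ → ℕ → ℕ
𝟙[ j     < zero  ] = 0
𝟙[ zero  < suc x ] = 1
𝟙[ suc j < suc x ] = 𝟙[ j < x ]

𝟙-< : ∀ {j x} → suc j ≤ x → 𝟙[ j < x ] ≡ 1
𝟙-< {zero}  (s≤s _)   = refl
𝟙-< {suc j} (s≤s j<x) = 𝟙-< j<x

𝟙-≮ : ∀ {j x} → ¬ suc j ≤ x → 𝟙[ j < x ] ≡ 0
𝟙-≮ {j}     {zero}  _   = refl
𝟙-≮ {zero}  {suc x} j≮x = contradiction (s≤s z≤n) j≮x
𝟙-≮ {suc j} {suc x} j≮x = 𝟙-≮ (λ j<x → j≮x (s≤s j<x))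

sumBelow-𝟙* : ∀ {x m} → x ≤ m → ∀ (g : ℕ → ℕ) → ∑[ j < m ] (𝟙[ j < x ] * g j) ≡ ∑[ j < x ] g j
sumBelow-𝟙* {zero}  {m}     _         g = trans (sumBelow-const m 0) (*-zeroʳ m)
sumBelow-𝟙* {suc x} {suc m} (s≤s x≤m) g =
  cong₂ _+_ (+-identityʳ (g 0)) (sumBelow-𝟙* x≤m (λ j → g (suc j)))

sumBelow-𝟙 : ∀ {x m} → x ≤ m → ∑[ j < m ] 𝟙[ j < x ] ≡ x
sumBelow-𝟙 {x} {m} x≤m = begin
  ∑[ j < m ] 𝟙[ j < x ]       ≡⟨ sumBelow-cong m (λ j → *-identityʳ 𝟙[ j < x ]) ⟨
  ∑[ j < m ] (𝟙[ j < x ] * 1) ≡⟨ sumBelow-𝟙* x≤m (λ _ → 1) ⟩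
  ∑[ j < x ] 1                ≡⟨ sumBelow-const x 1 ⟩
  x * 1                       ≡⟨ *-identityʳ x ⟩
  x                           ∎

columnLength : List ℕ → ℕ → ℕ
columnLength λs j = length (filter (λ p → suc j ≤? p) λs)

conjugate≡applyUpTo : ∀ λs → conjugate λs ≡ applyUpTo (columnLength λs) (largestPart λs)
conjugate≡applyUpTo λs = map-applyUpTo (λ j → j) (columnLength λs) (largestPart λs)

columnLength-∷ : ∀ x xs j → columnLength (x ∷ xs) j ≡ 𝟙[ j < x ] + columnLength xs j
columnLength-∷ x xs j with suc j ≤? x
... | yes j<x rewrite 𝟙-< j<x = cong length (filter-accept (λ p → suc j ≤? p) j<x)
... | no  j≮x rewrite 𝟙-≮ j≮x = cong length (filter-reject (λ p → suc j ≤? p) j≮x)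

sum-columnLength : ∀ {m} λs → All (_≤ m) λs → ∑[ j < m ] columnLength λs j ≡ sum λs
sum-columnLength {m} []       []           = trans (sumBelow-const m 0) (*-zeroʳ m)
sum-columnLength {m} (x ∷ xs) (x≤m ∷ xs≤m) = begin
  ∑[ j < m ] columnLength (x ∷ xs) j
    ≡⟨ sumBelow-cong m (columnLength-∷ x xs) ⟩
  ∑[ j < m ] (𝟙[ j < x ] + columnLength xs j)
    ≡⟨ sumBelow-+ m (λ j → 𝟙[ j < x ]) (columnLength xs) ⟩
  ∑[ j < m ] 𝟙[ j < x ] + ∑[ j < m ] columnLength xs j
    ≡⟨ cong₂ _+_ (sumBelow-𝟙 x≤m) (sum-columnLength xs xs≤m) ⟩
  x + sum xs ∎

triangle-𝟙+ : ∀ j x c → triangle (𝟙[ j < x ] + c) ≡ triangle c + 𝟙[ j < x ] * suc c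
triangle-𝟙+ j       zero    c = sym (+-identityʳ (triangle c))
triangle-𝟙+ zero    (suc x) c = trans (+-comm (suc c) (triangle c))
                                      (cong (_+_ (triangle c)) (sym (+-identityʳ (suc c))))
triangle-𝟙+ (suc j) (suc x) c = triangle-𝟙+ j x c

weightedSumFrom-suc : ∀ k xs → weightedSumFrom (suc k) xs ≡ weightedSumFrom k xs + sum xs
weightedSumFrom-suc k []       = refl
weightedSumFrom-suc k (x ∷ xs) rewrite weightedSumFrom-suc (suc k) xs =
  solve 4 (λ k x w s → x :+ k :* x :+ (w :+ s) := k :* x :+ w :+ (x :+ s))
          refl k x (weightedSumFrom (suc k) xs) (sum xs)

≤-head : ∀ {x xs} → Linked _≥_ (x ∷ xs) → All (_≤ x) (x ∷ xs)
≤-head = Linked⇒All (λ y≤x z≤y → ≤-trans z≤y y≤x) ≤-refl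

sum-triangle-columnLength : ∀ {m} λs → Linked _≥_ λs → All (_≤ m) λs →
                            ∑[ j < m ] triangle (columnLength λs j) ≡ weightedSum λs
sum-triangle-columnLength {m} []       _       []           = trans (sumBelow-const m 0) (*-zeroʳ m)
sum-triangle-columnLength {m} (x ∷ xs) nonincr (x≤m ∷ xs≤m) = begin
  ∑[ j < m ] triangle (columnLength (x ∷ xs) j)
    ≡⟨ sumBelow-cong m (λ j → trans (cong triangle (columnLength-∷ x xs j))
                                    (triangle-𝟙+ j x (columnLength xs j))) ⟩
  ∑[ j < m ] (triangle (columnLength xs j) + 𝟙[ j < x ] * suc (columnLength xs j))
    ≡⟨ sumBelow-+ m (λ j → triangle (columnLength xs j))
                    (λ j → 𝟙[ j < x ] * suc (columnLength xs j)) ⟩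
  ∑[ j < m ] triangle (columnLength xs j) + ∑[ j < m ] (𝟙[ j < x ] * suc (columnLength xs j))
    ≡⟨ cong₂ _+_ (sum-triangle-columnLength xs (Linked.tail nonincr) xs≤m)
                 (sumBelow-𝟙* x≤m (λ j → suc (columnLength xs j))) ⟩
  weightedSum xs + ∑[ j < x ] (1 + columnLength xs j)
    ≡⟨ cong (_+_ (weightedSum xs)) (sumBelow-+ x (λ _ → 1) (columnLength xs)) ⟩
  weightedSum xs + (∑[ j < x ] 1 + ∑[ j < x ] columnLength xs j)
    ≡⟨ cong (_+_ (weightedSum xs)) (cong₂ _+_ (trans (sumBelow-const x 1) (*-identityʳ x))
                                              (sum-columnLength xs (All.tail (≤-head nonincr)))) ⟩
  weightedSum xs + (x + sum xs)
    ≡⟨ solve 3 (λ w x s → w :+ (x :+ s) := x :+ (w :+ s)) refl (weightedSum xs) x (sum xs) ⟩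
  x + (weightedSum xs + sum xs)
    ≡⟨ cong₂ _+_ (sym (*-identityˡ x)) (sym (weightedSumFrom-suc 1 xs)) ⟩
  weightedSum (x ∷ xs) ∎

largestPart-≥ : ∀ λs → Linked _≥_ λs → All (_≤ largestPart λs) λs
largestPart-≥ []      _       = []
largestPart-≥ (_ ∷ _) nonincr = ≤-head nonincr

weightedSum+e₂-conjugate≡triangle : ∀ {n} λs → IsPartition n λs →
                                    weightedSum λs + e₂ (conjugate λs) ≡ triangle n
weightedSum+e₂-conjugate≡triangle {n} λs (_ , nonincr , sum≡n) = begin
  weightedSum λs + e₂ (conjugate λs)                      ≡⟨ cong (_+ e₂ (conjugate λs)) sum-triangle ⟨
  sum (map triangle (conjugate λs)) + e₂ (conjugate λs)   ≡⟨ triangle-sum (conjugate λs) ⟨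
  triangle (sum (conjugate λs))                           ≡⟨ cong triangle sum-conjugate ⟩
  triangle n                                              ∎
  where
  m = largestPart λs
  bounded = largestPart-≥ λs nonincr
  columns = conjugate≡applyUpTo λs
  sum-conjugate : sum (conjugate λs) ≡ n
  sum-conjugate = trans (cong sum columns) (trans (sum-columnLength λs bounded) sum≡n)
  sum-triangle : sum (map triangle (conjugate λs)) ≡ weightedSum λs
  sum-triangle = begin
    sum (map triangle (conjugate λs))                   ≡⟨ cong (λ μ → sum (map triangle μ)) columns ⟩
    sum (map triangle (applyUpTo (columnLength λs) m))  ≡⟨ cong sum (map-applyUpTo (columnLength λs) triangle m) ⟩
    ∑[ j < m ] triangle (columnLength λs j)             ≡⟨ sum-triangle-columnLength λs nonincr bounded ⟩
    weightedSum λs                                      ∎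

+[m+n]-+m≡+n : ∀ {m n k} → m + n ≡ k → + k - + m ≡ + n
+[m+n]-+m≡+n {m} {n} refl = begin
  + (m + n) - + m      ≡⟨ m-n≡m⊖n (m + n) m ⟩
  (m + n) ⊖ m          ≡⟨ cong ((m + n) ⊖_) (+-identityʳ m) ⟨
  (m + n) ⊖ (m + 0)    ≡⟨ +-cancelˡ-⊖ m n 0 ⟩
  + n                  ∎

proposition1 : (n : ℕ) → 1 ≤ n → (λs : List ℕ) → IsPartition n λs →
    gini n λs ≡ + (e₂ (conjugate λs))
proposition1 n _ λs partition =
  +[m+n]-+m≡+n (trans (weightedSum+e₂-conjugate≡triangle λs partition) (sym ([1+n]C2≡triangle n)))
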